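{- For every positive integer $n$, the clique number of $TCG_n$ equals $\pi(n)+1$, where $\pi(n)$ is the number of primes less than or equal to $n$.
   Context: For a positive integer $n$, $TCG_n$ denotes the simple graph (no loops) with vertex set $\{1,2,\ldots,n\}$ in which two distinct vertices $i,j$ are adjacent if and only if $\gcd(i,j)=1$. The clique number of a graph is the largest number of vertices of a complete subgraph. -}

module Defs where

open import Data.Nat using (ℕ; suc; _≤_; _<_)
open import Data.Nat.GCD using (gcd)
open import Data.Nat.Primality using (Prime; prime?)
open import Data.List using (List; length; filter; upTo)
open import Data.List.Relation.Unary.All using (All)
open import Data.List.Relation.Unary.AllPairs using (AllPairs)
open import Data.Product using (_×_; ∃)
open import Relation.Binary.PropositionalEquality using (_≡_; _≢_)

IsVertex : ℕ → ℕ → Set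
IsVertex n i = 1 ≤ i × i ≤ n

-- Adjacency in TCG_n (simple graph, no loops): distinct and coprime.
Adj : ℕ → ℕ → Set
Adj i j = i ≢ j × gcd i j ≡ 1

-- A clique of TCG_n, given as a list of vertices that are pairwise adjacent
-- (hence pairwise distinct); its number of vertices is its length.
IsClique : ℕ → List ℕ → Set
IsClique n c = All (IsVertex n) c × AllPairs Adj c

CliqueNumber : ℕ → ℕ → Set
CliqueNumber n k = (∃ λ c → IsClique n c × length c ≡ k)
                 × (∀ c → IsClique n c → length c ≤ k)

-- π(n): number of primes p with p ≤ n (upTo (suc n) = [0, 1, ..., n]).
primeCount : ℕ → ℕ
primeCount n = length (filter prime? (upTo (suc n)))

module Submission where

-- Map every vertex 1 ≤ x ≤ n to 1 if x = 1 and to one of its prime divisors otherwise.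
-- The image lies in {1} ∪ {primes ≤ n}, and two coprime vertices get distinct images
-- (a common image divides their gcd, so it is 1, which only the vertex 1 has); hence a
-- clique injects into {1} ∪ {primes ≤ n}, and {1} ∪ {primes ≤ n} is itself a clique.

open import Defs
open import Data.Nat using (ℕ; suc; _+_; _<_; _≤_; z≤n; s≤s; >-nonZero⁻¹)
open import Data.Nat.Properties using (*-comm; ≤-refl; ≤-trans; ≤-pred; <⇒≢; module ≤-Reasoning)
open import Data.Nat.Divisibility using (_∣_; divides; ∣⇒≤; ∣1⇒≡1)
open import Data.Nat.GCD using (gcd-greatest)
open import Data.Nat.Coprimality as Coprime using (coprime⇒gcd≡1; 1-coprimeTo; prime⇒coprime)
open import Data.Nat.Primality using (Prime; prime?; ¬prime[1]; prime⇒nonZero)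
open import Data.Nat.Primality.Factorisation using (factorise)
open import Data.List using (List; []; _∷_; length; filter; upTo)
open import Data.Nat.ListAction using (product)
open import Data.List.Properties using (length-map; length-removeAt′)
open import Data.List.Relation.Unary.All as All using (All; []; _∷_)
open import Data.List.Relation.Unary.All.Properties as All using ()
open import Data.List.Relation.Unary.AllPairs as AllPairs using (AllPairs; []; _∷_)
open import Data.List.Relation.Unary.AllPairs.Properties as AllPairs using ()
open import Data.List.Relation.Unary.Any using (here; there; _─_)
open import Data.List.Relation.Unary.Unique.Propositional using (Unique)
open import Data.List.Relation.Binary.Subset.Propositional using (_⊆_)
open import Data.List.Membership.Propositional using (_∈_)
open import Data.List.Membership.Propositional.Properties using (∈-filter⁺; ∈-filter⁻; ∈-upTo⁺; ∈-upTo⁻)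
open import Data.Product using (_×_; _,_; proj₁; proj₂; ∃-syntax)
open import Data.Empty using (⊥-elim)
open import Function using (_∘_)
open import Relation.Binary.PropositionalEquality as ≡ using (_≡_; _≢_; refl; subst)

private
  variable
    A : Set

∈-─⁺ : {x z : A} {ys : List A} (x∈ys : x ∈ ys) → z ∈ ys → z ≢ x → z ∈ (ys ─ x∈ys)
∈-─⁺ (here refl)  (here refl)  z≢x = ⊥-elim (z≢x refl)
∈-─⁺ (here refl)  (there z∈ys) _   = z∈ys
∈-─⁺ (there _)    (here refl)  _   = here refl
∈-─⁺ (there x∈ys) (there z∈ys) z≢x = there (∈-─⁺ x∈ys z∈ys z≢x)

unique-⊆⇒length-≤ : {xs ys : List A} → Unique xs → xs ⊆ ys → length xs ≤ length ys
unique-⊆⇒length-≤                    []           _     = z≤n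
unique-⊆⇒length-≤ {xs = x ∷ xs} {ys} (x∉xs ∷ xs!) xs⊆ys = begin
  suc (length xs)           ≤⟨ s≤s (unique-⊆⇒length-≤ xs! xs⊆ys─x) ⟩
  suc (length (ys ─ x∈ys)) ≡⟨ ≡.sym (length-removeAt′ ys _) ⟩
  length ys                 ∎
  where
  open ≤-Reasoning
  x∈ys : x ∈ ys
  x∈ys = xs⊆ys (here refl)
  xs⊆ys─x : xs ⊆ (ys ─ x∈ys)
  xs⊆ys─x z∈xs = ∈-─⁺ x∈ys (xs⊆ys (there z∈xs)) (All.lookup x∉xs z∈xs ∘ ≡.sym)

AllPairs-strengthen : {P : A → Set} {R S : A → A → Set} {xs : List A} →
                      (∀ {x y} → P x → P y → R x y → S x y) →
                      All P xs → AllPairs R xs → AllPairs S xs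
AllPairs-strengthen _ []         []         = []
AllPairs-strengthen h (px ∷ pxs) (rx ∷ rxs) =
  All.zipWith (λ (py , r) → h px py r) (pxs , rx) ∷ AllPairs-strengthen h pxs rxs

primeDivisor : ∀ k → ∃[ p ] Prime p × p ∣ 2 + k
primeDivisor k with factorise (2 + k)
... | record { factors = [] ; isFactorisation = () }
... | record { factors = p ∷ ps ; isFactorisation = eq ; factorsPrime = prime-p ∷ _ } =
  p , prime-p , divides (product ps) (≡.trans eq (*-comm p (product ps)))

-- Any label works for 0, which is not a vertex; 0 keeps `primeOrOne n ∣ n` unconditional.
primeOrOne : ℕ → ℕ
primeOrOne 0             = 0
primeOrOne 1             = 1
primeOrOne (suc (suc k)) = proj₁ (primeDivisor k)

primeOrOne∣ : ∀ n → primeOrOne n ∣ n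
primeOrOne∣ 0             = divides 0 refl
primeOrOne∣ 1             = divides 1 refl
primeOrOne∣ (suc (suc k)) = proj₂ (proj₂ (primeDivisor k))

primeOrOne≡1⇒≡1 : ∀ n → primeOrOne n ≡ 1 → n ≡ 1
primeOrOne≡1⇒≡1 1             _  = refl
primeOrOne≡1⇒≡1 (suc (suc k)) eq =
  ⊥-elim (¬prime[1] (subst Prime eq (proj₁ (proj₂ (primeDivisor k)))))

primeOrOne-injectiveOnAdj : ∀ {x y} → Adj x y → primeOrOne x ≢ primeOrOne y
primeOrOne-injectiveOnAdj {x} {y} (x≢y , gcd≡1) fx≡fy =
  x≢y (≡.trans (primeOrOne≡1⇒≡1 x fx≡1) (≡.sym (primeOrOne≡1⇒≡1 y fy≡1)))
  where
  fx≡1 : primeOrOne x ≡ 1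
  fx≡1 = ∣1⇒≡1 (subst (primeOrOne x ∣_) gcd≡1
           (gcd-greatest (primeOrOne∣ x) (subst (_∣ y) (≡.sym fx≡fy) (primeOrOne∣ y))))
  fy≡1 : primeOrOne y ≡ 1
  fy≡1 = ≡.trans (≡.sym fx≡fy) fx≡1

primesUpTo : ℕ → List ℕ
primesUpTo n = filter prime? (upTo (suc n))

∈-primesUpTo⁺ : ∀ {n p} → Prime p → p ≤ n → p ∈ primesUpTo n
∈-primesUpTo⁺ prime-p p≤n = ∈-filter⁺ prime? (∈-upTo⁺ (s≤s p≤n)) prime-p

∈-primesUpTo⁻ : ∀ {n p} → p ∈ primesUpTo n → Prime p × p ≤ n
∈-primesUpTo⁻ p∈ with ∈-filter⁻ prime? p∈
... | p∈upTo , prime-p = prime-p , ≤-pred (∈-upTo⁻ p∈upTo)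

primesUpTo-strictlyIncreasing : ∀ n → AllPairs _<_ (primesUpTo n)
primesUpTo-strictlyIncreasing n =
  AllPairs.filter⁺ prime? (AllPairs.applyUpTo⁺₁ (λ i → i) (suc n) (λ i<j _ → i<j))

primeOrOne∈oneAndPrimesUpTo : ∀ {n x} → IsVertex n x → primeOrOne x ∈ (1 ∷ primesUpTo n)
primeOrOne∈oneAndPrimesUpTo {x = 1}           _         = here refl
primeOrOne∈oneAndPrimesUpTo {x = suc (suc k)} (_ , x≤n) with primeDivisor k
... | p , prime-p , p∣x = there (∈-primesUpTo⁺ prime-p (≤-trans (∣⇒≤ p∣x) x≤n))

clique⇒length≤ : ∀ {n} c → IsClique n c → length c ≤ suc (primeCount n)
clique⇒length≤ {n} c (vertices , adjacent) =
  subst (_≤ suc (primeCount n)) (length-map primeOrOne c)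
    (unique-⊆⇒length-≤ (AllPairs.map⁺ (AllPairs.map primeOrOne-injectiveOnAdj adjacent))
      (All.lookup (All.map⁺ (All.map primeOrOne∈oneAndPrimesUpTo vertices))))

<-primes⇒Adj : ∀ {p q} → Prime p → Prime q → p < q → Adj p q
<-primes⇒Adj prime-p prime-q p<q =
  <⇒≢ p<q , coprime⇒gcd≡1 (Coprime.sym (prime⇒coprime prime-q {{prime⇒nonZero prime-p}} p<q))

one-Adj-prime : ∀ {p} → Prime p → Adj 1 p
one-Adj-prime {p} prime-p =
  (λ 1≡p → ¬prime[1] (subst Prime (≡.sym 1≡p) prime-p)) , coprime⇒gcd≡1 (1-coprimeTo p)

oneAndPrimesUpTo-isClique : ∀ {n} → 1 ≤ n → IsClique n (1 ∷ primesUpTo n)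
oneAndPrimesUpTo-isClique {n} 1≤n =
  (≤-refl , 1≤n) ∷ All.map isVertex primes≤n ,
  All.map (one-Adj-prime ∘ proj₁) primes≤n ∷
  AllPairs-strengthen (λ (prime-p , _) (prime-q , _) → <-primes⇒Adj prime-p prime-q)
    primes≤n (primesUpTo-strictlyIncreasing n)
  where
  primes≤n : All (λ p → Prime p × p ≤ n) (primesUpTo n)
  primes≤n = All.tabulate ∈-primesUpTo⁻
  isVertex : ∀ {p} → Prime p × p ≤ n → IsVertex n p
  isVertex {p} (prime-p , p≤n) = >-nonZero⁻¹ p {{prime⇒nonZero prime-p}} , p≤n

mainTheorem5 : (n : ℕ) → 0 < n → CliqueNumber n (suc (primeCount n))
mainTheorem5 n 0<n = (1 ∷ primesUpTo n , oneAndPrimesUpTo-isClique 0<n , refl) , clique⇒length≤
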